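{- The logic $\mathbf{W}$ is strongly complete with respect to the class of all $\mathsf{W}$-PN-frames, and also with respect to the class of those PN-frames satisfying: for all $w,v\in W$, $X\subseteq W$, if $w\leq v$ and $X\in\mathcal{N}_w$ then $X\in\mathcal{N}_v$. That is, for each of these classes, for every set $\Gamma$ of formulas and formula $\varphi$ with $\Gamma\nvdash_{\mathbf{W}}\varphi$, there is a model based on a frame of the class and a world of it forcing every member of $\Gamma$ but not forcing $\varphi$.
   Context: Formulas are built from a countable set $PV$ of propositional variables and $\bot$ by $\land,\lor,\rightarrow$ and a unary modal operator $\mathsf{W}$; $\lnot\varphi$ abbreviates $\varphi\to\bot$, $\varphi\leftrightarrow\psi$ abbreviates $(\varphi\to\psi)\land(\psi\to\varphi)$. The logic $\mathbf{W}$ is the smallest set of formulas containing all instances of the axiom schemes of intuitionistic propositional logic and all instances of $\mathsf{W}\varphi\to\lnot\varphi$, closed under modus ponens and the rule: from $\varphi\leftrightarrow\psi$ infer $\mathsf{W}\varphi\leftrightarrow\mathsf{W}\psi$. $\Gamma\vdash_{\mathbf{W}}\varphi$ means there are $\gamma_1,\dots,\gamma_n\in\Gamma$ ($n\geq0$) with $(\gamma_1\land\dots\land\gamma_n)\to\varphi\in\mathbf{W}$. A PN-frame is $\langle W,\mathcal{N},\leq\rangle$ with $\leq$ a partial order on $W$ and $\mathcal{N}:W\to P(P(W))$. A $\mathsf{W}$-PN-frame is a PN-frame such that for all $w,v\in W$, $X\subseteq W$: if $w\leq v$, $X\in\mathcal{N}_w$ and $v\notin X$, then $X\in\mathcal{N}_v$.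 A model on a frame adds $V:PV\to P(W)$ with each $V(q)$ upward closed. Forcing: $w\nVdash\bot$; $w\Vdash q$ iff $w\in V(q)$; $\land,\lor$ pointwise; $w\Vdash\varphi\to\psi$ iff for all $v\geq w$, $v\nVdash\varphi$ or $v\Vdash\psi$; $w\Vdash\mathsf{W}\varphi$ iff $w\Vdash\lnot\varphi$ and $V(\varphi)\in\mathcal{N}_w$, where $V(\varphi)=\{z:z\Vdash\varphi\}$. -}

module Defs where

open import Level using (Level; _⊔_) renaming (suc to lsuc; zero to lzero)
open import Data.Nat using (ℕ)
open import Data.List using (List; []; _∷_)
open import Data.List.Relation.Unary.All using (All)
open import Data.Product using (Σ; _×_; _,_)
open import Data.Sum using (_⊎_)
open import Data.Empty.Polymorphic using () renaming (⊥ to ⊥ₚ)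
open import Relation.Nullary using (¬_)
open import Relation.Binary.PropositionalEquality using (_≡_)
open import Relation.Binary.Structures using (IsPartialOrder)
open import Function.Bundles using (_⇔_)

infixr 6 _∧'_
infixr 5 _∨'_
infixr 4 _⇒_

data Formula : Set where
  var   : ℕ → Formula
  ⊥'    : Formula
  _∧'_  : Formula → Formula → Formula
  _∨'_  : Formula → Formula → Formula
  _⇒_   : Formula → Formula → Formula
  𝖶     : Formula → Formula

∼_ : Formula → Formula
∼ φ = φ ⇒ ⊥'

_⇔'_ : Formula → Formula → Formula
φ ⇔' ψ = (φ ⇒ ψ) ∧' (ψ ⇒ φ)

data Thm : Formula → Set where
  ax-K    : ∀ φ ψ → Thm (φ ⇒ ψ ⇒ φ)
  ax-S    : ∀ φ ψ χ → Thm ((φ ⇒ ψ ⇒ χ) ⇒ (φ ⇒ ψ) ⇒ φ ⇒ χ)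
  ax-∧E₁  : ∀ φ ψ → Thm (φ ∧' ψ ⇒ φ)
  ax-∧E₂  : ∀ φ ψ → Thm (φ ∧' ψ ⇒ ψ)
  ax-∧I   : ∀ φ ψ → Thm (φ ⇒ ψ ⇒ φ ∧' ψ)
  ax-∨I₁  : ∀ φ ψ → Thm (φ ⇒ φ ∨' ψ)
  ax-∨I₂  : ∀ φ ψ → Thm (ψ ⇒ φ ∨' ψ)
  ax-∨E   : ∀ φ ψ χ → Thm ((φ ⇒ χ) ⇒ (ψ ⇒ χ) ⇒ φ ∨' ψ ⇒ χ)
  ax-⊥E   : ∀ φ → Thm (⊥' ⇒ φ)
  ax-W    : ∀ φ → Thm (𝖶 φ ⇒ ∼ φ)
  mp      : ∀ {φ ψ} → Thm (φ ⇒ ψ) → Thm φ → Thm ψ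
  re-W    : ∀ {φ ψ} → Thm (φ ⇔' ψ) → Thm (𝖶 φ ⇔' 𝖶 ψ)

bigAnd : Formula → List Formula → Formula
bigAnd γ []       = γ
bigAnd γ (δ ∷ δs) = γ ∧' bigAnd δ δs

premises⇒ : List Formula → Formula → Formula
premises⇒ []       φ = φ
premises⇒ (γ ∷ γs) φ = bigAnd γ γs ⇒ φ

_⊢W_ : (Formula → Set) → Formula → Set
Γ ⊢W φ = Σ (List Formula) λ γs → All Γ γs × Thm (premises⇒ γs φ)

-- PN-frames. Subsets of W are predicates W → Set a; since 𝒩_w is meant
-- to be a set of subsets, 𝒩_w is required to respect extensional
-- equality of subsets.

record PNFrame (a : Level) : Set (lsuc a) where
  field
    World   : Set a
    _≤_     : World → World → Set a
    isPO    : IsPartialOrder _≡_ _≤_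
    𝒩       : World → (World → Set a) → Set a
    𝒩-ext   : ∀ w (X Y : World → Set a) → (∀ z → X z ⇔ Y z) → 𝒩 w X → 𝒩 w Y

module _ {a : Level} (F : PNFrame a) where
  open PNFrame F

  IsWFrame : Set (lsuc a)
  IsWFrame = ∀ w v (X : World → Set a) → w ≤ v → 𝒩 w X → ¬ X v → 𝒩 v X

  IsMonotoneFrame : Set (lsuc a)
  IsMonotoneFrame = ∀ w v (X : World → Set a) → w ≤ v → 𝒩 w X → 𝒩 v X

record Model {a : Level} (F : PNFrame a) : Set (lsuc a) where
  open PNFrame F
  field
    V        : ℕ → World → Set a
    V-upward : ∀ q w v → w ≤ v → V q w → V q v

module _ {a : Level} {F : PNFrame a} (M : Model F) where
  open PNFrame F
  open Model M

  _⊩_ : World → Formula → Set a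
  w ⊩ var q   = V q w
  w ⊩ ⊥'      = ⊥ₚ
  w ⊩ (φ ∧' ψ) = (w ⊩ φ) × (w ⊩ ψ)
  w ⊩ (φ ∨' ψ) = (w ⊩ φ) ⊎ (w ⊩ ψ)
  w ⊩ (φ ⇒ ψ) = ∀ v → w ≤ v → ¬ (v ⊩ φ) ⊎ (v ⊩ ψ)
  w ⊩ 𝖶 φ     = (∀ v → w ≤ v → ¬ (v ⊩ φ) ⊎ (v ⊩ ⊥')) × 𝒩 w (λ z → z ⊩ φ)

StronglyComplete : (PNFrame (lsuc lzero) → Set (lsuc (lsuc lzero))) → Set (lsuc (lsuc lzero))
StronglyComplete Class =
  (Γ : Formula → Set) (φ : Formula) → ¬ (Γ ⊢W φ) →
  Σ (PNFrame (lsuc lzero)) λ F → Class F ×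
  Σ (Model F) λ M → Σ (PNFrame.World F) λ w →
  (∀ γ → Γ γ → _⊩_ M w γ) × ¬ (_⊩_ M w φ)

{-# OPTIONS --safe #-}
module Submission where

-- A canonical model argument. The worlds are the prime theories of W, ordered
-- by inclusion; every consistent set extends to one by the Lindenbaum
-- construction (enumerate all formulas, add each one unless it makes the
-- target formula derivable; excluded middle decides derivability). The
-- neighbourhoods of w are the truth sets of the β with 𝖶β ∈ w. In the truth
-- lemma for 𝖶α, a truth set of α that is also the truth set of β forces α and β
-- to lie in the same prime theories, hence ⊢ α ↔ β, and the congruence rule
-- turns 𝖶β ∈ w into 𝖶α ∈ w. Neighbourhoods are inherited along inclusion
-- because they are given by formulas of w, so the canonical frame is monotone
-- and a fortiori a 𝖶-frame.

open import Defs
open import Level using (Lift; lift; lower; 0ℓ) renaming (suc to lsuc; zero to lzero)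
open import Data.Product using (_×_; Σ; ∃; _,_)
open import Data.Sum using (_⊎_; inj₁; inj₂; [_,_]) renaming (map to ⊎-map)
open import Data.Empty using (⊥-elim)
open import Data.Nat using (ℕ; zero; suc; _⊔_; _≤′_; ≤′-refl; ≤′-step)
open import Data.Nat.Properties using (m≤m⊔n; m≤n⊔m; ≤⇒≤′)
open import Data.List using (List; []; _∷_; _++_; map; concatMap; foldl; cartesianProductWith)
open import Data.List.Relation.Unary.All using (All; []; _∷_)
open import Data.List.Relation.Unary.All.Properties using (++⁺)
open import Data.List.Relation.Unary.Any using (here; there)
import Data.List.Relation.Unary.Any as Any
open import Data.List.Membership.Propositional using (_∈_)
open import Data.List.Membership.Propositional.Properties
  using (∈-map⁺; ∈-++⁺ˡ; ∈-++⁺ʳ; ∈-concatMap⁺; ∈-cartesianProductWith⁺)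
open import Relation.Nullary using (¬_; Dec; yes; no)
open import Relation.Nullary.Decidable using (map′)
open import Relation.Unary using (Pred; ∅; ｛_｝; _∪_; _⊆_; _≐_)
open import Relation.Binary.Core using (Rel)
open import Relation.Binary.PropositionalEquality using (_≡_; refl; isEquivalence)
open import Relation.Binary.Structures using (IsStrictPartialOrder)
import Relation.Binary.Construct.StrictToNonStrict as StrictToNonStrict
open import Function using (id; _∘_)
open import Function.Bundles using (_⇔_; mk⇔; Equivalence)
open import Axiom.ExcludedMiddle using (ExcludedMiddle)

open Equivalence using (to; from)

ascending⇒⊆ : ∀ {a ℓ} {A : Set a} (P : ℕ → Pred A ℓ) →
              (∀ n → P n ⊆ P (suc n)) → ∀ {m n} → m ≤′ n → P m ⊆ P n
ascending⇒⊆ P step ≤′-refl         = id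
ascending⇒⊆ P step (≤′-step m≤′n) = step _ ∘ ascending⇒⊆ P step m≤′n

infix 3.5 _⊢_

data _⊢_ (Γ : Pred Formula 0ℓ) : Formula → Set where
  hyp : ∀ {φ} → Γ φ → Γ ⊢ φ
  thm : ∀ {φ} → Thm φ → Γ ⊢ φ
  mp  : ∀ {φ ψ} → Γ ⊢ φ ⇒ ψ → Γ ⊢ φ → Γ ⊢ ψ

⊢-mono : ∀ {Γ Δ} → Γ ⊆ Δ → (Γ ⊢_) ⊆ (Δ ⊢_)
⊢-mono Γ⊆Δ (hyp γ)  = hyp (Γ⊆Δ γ)
⊢-mono Γ⊆Δ (thm t)  = thm t
⊢-mono Γ⊆Δ (mp d e) = mp (⊢-mono Γ⊆Δ d) (⊢-mono Γ⊆Δ e)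

⊢-cut : ∀ {Γ Δ} → Γ ⊆ (Δ ⊢_) → (Γ ⊢_) ⊆ (Δ ⊢_)
⊢-cut Γ⊢Δ (hyp γ)  = Γ⊢Δ γ
⊢-cut Γ⊢Δ (thm t)  = thm t
⊢-cut Γ⊢Δ (mp d e) = mp (⊢-cut Γ⊢Δ d) (⊢-cut Γ⊢Δ e)

⊢-id : ∀ {Γ} α → Γ ⊢ α ⇒ α
⊢-id α = mp (mp (thm (ax-S α (α ⇒ α) α)) (thm (ax-K α (α ⇒ α)))) (thm (ax-K α α))

deduction : ∀ {Γ α β} → Γ ∪ ｛ α ｝ ⊢ β → Γ ⊢ α ⇒ β
deduction {α = α} (hyp (inj₁ γ))    = mp (thm (ax-K _ α)) (hyp γ)
deduction {α = α} (hyp (inj₂ refl)) = ⊢-id α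
deduction {α = α} (thm t)           = mp (thm (ax-K _ α)) (thm t)
deduction {α = α} (mp {φ} {ψ} d e)  = mp (mp (thm (ax-S α φ ψ)) (deduction d)) (deduction e)

∅⊢⇒Thm : ∀ {φ} → ∅ ⊢ φ → Thm φ
∅⊢⇒Thm (thm t)  = t
∅⊢⇒Thm (mp d e) = mp (∅⊢⇒Thm d) (∅⊢⇒Thm e)

⊢-finite : ∀ {Γ φ} → Γ ⊢ φ → Σ (List Formula) λ γs → All Γ γs × (_∈ γs) ⊢ φ
⊢-finite {φ = φ} (hyp γ) = φ ∷ [] , γ ∷ [] , hyp (here refl)
⊢-finite (thm t) = [] , [] , thm t
⊢-finite (mp d e) with ⊢-finite d | ⊢-finite e
... | γs , Γγs , d′ | δs , Γδs , e′ =
  γs ++ δs , ++⁺ Γγs Γδs , mp (⊢-mono ∈-++⁺ˡ d′) (⊢-mono (∈-++⁺ʳ γs) e′)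

bigAnd-elim : ∀ γ γs → (_∈ γ ∷ γs) ⊆ (∅ ∪ ｛ bigAnd γ γs ｝ ⊢_)
bigAnd-elim γ []       (here refl) = hyp (inj₂ refl)
bigAnd-elim γ (δ ∷ δs) (here refl) = mp (thm (ax-∧E₁ γ (bigAnd δ δs))) (hyp (inj₂ refl))
bigAnd-elim γ (δ ∷ δs) (there p)   = ⊢-cut second (bigAnd-elim δ δs p)
  where
  second : ∅ ∪ ｛ bigAnd δ δs ｝ ⊆ (∅ ∪ ｛ bigAnd γ (δ ∷ δs) ｝ ⊢_)
  second (inj₂ refl) = mp (thm (ax-∧E₂ γ (bigAnd δ δs))) (hyp (inj₂ refl))

premises⇒-intro : ∀ γs {φ} → (_∈ γs) ⊢ φ → Thm (premises⇒ γs φ)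
premises⇒-intro []       d = ∅⊢⇒Thm (⊢-mono (λ ()) d)
premises⇒-intro (γ ∷ γs) d = ∅⊢⇒Thm (deduction (⊢-cut (bigAnd-elim γ γs) d))

⊢⇒⊢W : ∀ {Γ φ} → Γ ⊢ φ → Γ ⊢W φ
⊢⇒⊢W d with ⊢-finite d
... | γs , Γγs , d′ = γs , Γγs , premises⇒-intro γs d′

connectives : List (Formula → Formula → Formula)
connectives = _∧'_ ∷ _∨'_ ∷ _⇒_ ∷ []

combinations : List Formula → (Formula → Formula → Formula) → List Formula
combinations xs _∙_ = cartesianProductWith _∙_ xs xs

compounds : List Formula → List Formula
compounds xs = map 𝖶 xs ++ concatMap (combinations xs) connectives

formulas : ℕ → List Formula
formulas zero    = []
formulas (suc n) = formulas n ++ ⊥' ∷ var n ∷ compounds (formulas n)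

formulas-mono : ∀ {m n} → m ≤′ n → (_∈ formulas m) ⊆ (_∈ formulas n)
formulas-mono = ascending⇒⊆ (λ n → _∈ formulas n) (λ _ → ∈-++⁺ˡ)

compound∈formulas : ∀ n {ψ} → ψ ∈ compounds (formulas n) → ψ ∈ formulas (suc n)
compound∈formulas n p = ∈-++⁺ʳ (formulas n) (there (there p))

binary∈formulas : ∀ {_∙_ α β} → _∙_ ∈ connectives →
                  ∃ (λ m → α ∈ formulas m) → ∃ (λ n → β ∈ formulas n) →
                  ∃ λ k → α ∙ β ∈ formulas k
binary∈formulas {_∙_} {α} {β} ∙∈ (m , α∈) (n , β∈) =
  suc k , compound∈formulas k (∈-++⁺ʳ (map 𝖶 (formulas k))
    (∈-concatMap⁺ (combinations (formulas k)) (Any.map (λ { refl → α∙β∈ }) ∙∈)))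
  where
  k = m ⊔ n
  α∙β∈ : α ∙ β ∈ combinations (formulas k) _∙_
  α∙β∈ = ∈-cartesianProductWith⁺ _∙_ (formulas-mono (≤⇒≤′ (m≤m⊔n m n)) α∈)
                                      (formulas-mono (≤⇒≤′ (m≤n⊔m m n)) β∈)

∈-formulas : ∀ ψ → ∃ λ n → ψ ∈ formulas n
∈-formulas (var q)  = suc q , ∈-++⁺ʳ (formulas q) (there (here refl))
∈-formulas ⊥'       = 1 , here refl
∈-formulas (α ∧' β) = binary∈formulas (here refl) (∈-formulas α) (∈-formulas β)
∈-formulas (α ∨' β) = binary∈formulas (there (here refl)) (∈-formulas α) (∈-formulas β)
∈-formulas (α ⇒ β)  = binary∈formulas (there (there (here refl))) (∈-formulas α) (∈-formulas β)
∈-formulas (𝖶 α) with ∈-formulas α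
... | n , α∈ = suc n , compound∈formulas n (∈-++⁺ˡ (∈-map⁺ 𝖶 α∈))

record PrimeTheory : Set₁ where
  infix 3.5 _∋_
  field
    _∋_        : Formula → Set
    closed     : (_∋_ ⊢_) ⊆ _∋_
    consistent : ¬ _∋_ ⊥'
    prime      : ∀ {α β} → _∋_ (α ∨' β) → _∋_ α ⊎ _∋_ β
open PrimeTheory

∋-mp : ∀ w {α β} → Thm (α ⇒ β) → w ∋ α → w ∋ β
∋-mp w t a = closed w (mp (thm t) (hyp a))

-- Prime theories are predicates, so inclusion is antisymmetric only up to
-- extensional equality; the canonical order is therefore identity or strict
-- inclusion witnessed by a formula, which is a partial order for _≡_.
_⊂_ : Rel PrimeTheory 0ℓ
w ⊂ v = (w ∋_) ⊆ (v ∋_) × ∃ λ α → v ∋ α × ¬ w ∋ α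

⊂-isStrictPartialOrder : IsStrictPartialOrder _≡_ _⊂_
⊂-isStrictPartialOrder = record
  { isEquivalence = isEquivalence
  ; irrefl        = λ { refl (_ , α , v∋α , v∌α) → v∌α v∋α }
  ; trans         = λ { (u⊆v , α , v∋α , u∌α) (v⊆w , _) → v⊆w ∘ u⊆v , α , v⊆w v∋α , u∌α }
  ; <-resp-≈      = (λ { refl u⊂v → u⊂v }) , (λ { refl u⊂v → u⊂v })
  }

open StrictToNonStrict _≡_ _⊂_ using () renaming (_≤_ to _⊑_; isPartialOrder to ⊑-isPartialOrder)

⊑⇒⊆ : ∀ {w v} → w ⊑ v → (w ∋_) ⊆ (v ∋_)
⊑⇒⊆ (inj₁ (w⊆v , _)) = w⊆v
⊑⇒⊆ (inj₂ refl)      = id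

𝒩ᶜ : PrimeTheory → Pred PrimeTheory (lsuc lzero) → Set₁
𝒩ᶜ w X = ∃ λ β → w ∋ 𝖶 β × X ≐ (_∋ β)

canonicalFrame : PNFrame (lsuc lzero)
canonicalFrame = record
  { World = PrimeTheory
  ; _≤_   = _⊑_
  ; isPO  = ⊑-isPartialOrder ⊂-isStrictPartialOrder
  ; 𝒩     = 𝒩ᶜ
  ; 𝒩-ext = λ { w X Y X⇔Y (β , 𝖶β∈ , X⊆ , ⊆X) →
                β , 𝖶β∈ , X⊆ ∘ from (X⇔Y _) , to (X⇔Y _) ∘ ⊆X }
  }

canonicalFrame-monotone : IsMonotoneFrame canonicalFrame
canonicalFrame-monotone w v X w⊑v (β , 𝖶β∈ , X≐β) = β , ⊑⇒⊆ w⊑v 𝖶β∈ , X≐β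

monotone⇒WFrame : ∀ {a} (F : PNFrame a) → IsMonotoneFrame F → IsWFrame F
monotone⇒WFrame F monotone w v X w≤v X∈𝒩w _ = monotone w v X w≤v X∈𝒩w

canonicalModel : Model canonicalFrame
canonicalModel = record
  { V        = λ q w → Lift (lsuc lzero) (w ∋ var q)
  ; V-upward = λ q w v w⊑v → lift ∘ ⊑⇒⊆ w⊑v ∘ lower
  }

infix 3.5 _⊩ᶜ_

_⊩ᶜ_ : PrimeTheory → Formula → Set₁
w ⊩ᶜ α = _⊩_ canonicalModel w α

TruthLemma : Formula → Set₁
TruthLemma α = ∀ w → w ⊩ᶜ α ⇔ w ∋ α

module _ (lem : ExcludedMiddle (lsuc lzero)) where

  decide : (P : Set) → Dec P
  decide P = map′ lower lift lem

  module Lindenbaum (Γ : Pred Formula 0ℓ) (φ : Formula) (Γ⊬φ : ¬ Γ ⊢ φ) where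

    -- A predicate, so the chain is defined without deciding derivability;
    -- excluded middle is only needed to reason about it.
    extend : Pred Formula 0ℓ → Formula → Pred Formula 0ℓ
    extend Δ ψ = Δ ∪ λ x → ψ ≡ x × ¬ Δ ∪ ｛ ψ ｝ ⊢ φ

    extendAll : Pred Formula 0ℓ → List Formula → Pred Formula 0ℓ
    extendAll = foldl extend

    extendAll-⊇ : ∀ Δ xs → Δ ⊆ extendAll Δ xs
    extendAll-⊇ Δ []       = id
    extendAll-⊇ Δ (y ∷ xs) = extendAll-⊇ (extend Δ y) xs ∘ inj₁

    extend-⊬ : ∀ Δ ψ → ¬ Δ ⊢ φ → ¬ extend Δ ψ ⊢ φ
    extend-⊬ Δ ψ Δ⊬φ d with decide (Δ ∪ ｛ ψ ｝ ⊢ φ)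
    ... | yes Δψ⊢φ = Δ⊬φ (⊢-mono (λ { (inj₁ δ) → δ ; (inj₂ (_ , Δψ⊬φ)) → ⊥-elim (Δψ⊬φ Δψ⊢φ) }) d)
    ... | no Δψ⊬φ  = Δψ⊬φ (⊢-mono (λ { (inj₁ δ) → inj₁ δ ; (inj₂ (ψ≡ , _)) → inj₂ ψ≡ }) d)

    extendAll-⊬ : ∀ Δ xs → ¬ Δ ⊢ φ → ¬ extendAll Δ xs ⊢ φ
    extendAll-⊬ Δ []       = id
    extendAll-⊬ Δ (y ∷ xs) = extendAll-⊬ (extend Δ y) xs ∘ extend-⊬ Δ y

    Settles : Pred Formula 0ℓ → Formula → Set
    Settles Δ ψ = Δ ψ ⊎ Δ ∪ ｛ ψ ｝ ⊢ φ

    settles-mono : ∀ {Δ Δ′} → Δ ⊆ Δ′ → ∀ {ψ} → Settles Δ ψ → Settles Δ′ ψ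
    settles-mono Δ⊆Δ′ (inj₁ δ) = inj₁ (Δ⊆Δ′ δ)
    settles-mono Δ⊆Δ′ (inj₂ d) = inj₂ (⊢-mono (λ { (inj₁ δ) → inj₁ (Δ⊆Δ′ δ) ; (inj₂ e) → inj₂ e }) d)

    extend-settles : ∀ Δ ψ → Settles (extend Δ ψ) ψ
    extend-settles Δ ψ with decide (Δ ∪ ｛ ψ ｝ ⊢ φ)
    ... | yes Δψ⊢φ = inj₂ (⊢-mono (λ { (inj₁ δ) → inj₁ (inj₁ δ) ; (inj₂ e) → inj₂ e }) Δψ⊢φ)
    ... | no Δψ⊬φ  = inj₁ (inj₂ (refl , Δψ⊬φ))

    extendAll-settles : ∀ Δ {ψ} xs → ψ ∈ xs → Settles (extendAll Δ xs) ψ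
    extendAll-settles Δ (ψ ∷ xs) (here refl) =
      settles-mono (extendAll-⊇ (extend Δ ψ) xs) (extend-settles Δ ψ)
    extendAll-settles Δ (y ∷ xs) (there p) = extendAll-settles (extend Δ y) xs p

    chain : ℕ → Pred Formula 0ℓ
    chain zero    = Γ
    chain (suc n) = extendAll (chain n) (formulas n)

    chain-mono : ∀ {m n} → m ≤′ n → chain m ⊆ chain n
    chain-mono = ascending⇒⊆ chain (λ n → extendAll-⊇ (chain n) (formulas n))

    chain-⊬ : ∀ n → ¬ chain n ⊢ φ
    chain-⊬ zero    = Γ⊬φ
    chain-⊬ (suc n) = extendAll-⊬ (chain n) (formulas n) (chain-⊬ n)

    limit : Pred Formula 0ℓ
    limit χ = ∃ λ n → chain n χ

    limit-compact : ∀ {χ} → limit ⊢ χ → ∃ λ n → chain n ⊢ χ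
    limit-compact (hyp (n , δ)) = n , hyp δ
    limit-compact (thm t)       = 0 , thm t
    limit-compact (mp d e) with limit-compact d | limit-compact e
    ... | m , d′ | n , e′ =
      m ⊔ n , mp (⊢-mono (chain-mono (≤⇒≤′ (m≤m⊔n m n))) d′)
                 (⊢-mono (chain-mono (≤⇒≤′ (m≤n⊔m m n))) e′)

    limit-⊬ : ¬ limit ⊢ φ
    limit-⊬ d with limit-compact d
    ... | n , d′ = chain-⊬ n d′

    limit-settles : ∀ ψ → Settles limit ψ
    limit-settles ψ with ∈-formulas ψ
    ... | n , p = settles-mono (suc n ,_) (extendAll-settles (chain n) (formulas n) p)

    limit-closed : (limit ⊢_) ⊆ limit
    limit-closed {α} d with limit-settles α
    ... | inj₁ α∈ = α∈
    ... | inj₂ e  = ⊥-elim (limit-⊬ (mp (deduction e) d))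

    limit-prime : ∀ {α β} → limit (α ∨' β) → limit α ⊎ limit β
    limit-prime {α} {β} α∨β∈ with limit-settles α | limit-settles β
    ... | inj₁ α∈ | _      = inj₁ α∈
    ... | inj₂ _  | inj₁ β∈ = inj₂ β∈
    ... | inj₂ d  | inj₂ e  =
      ⊥-elim (limit-⊬ (mp (mp (mp (thm (ax-∨E α β φ)) (deduction d)) (deduction e)) (hyp α∨β∈)))

    theory : PrimeTheory
    theory = record
      { _∋_        = limit
      ; closed     = limit-closed
      ; consistent = λ ⊥∈ → limit-⊬ (mp (thm (ax-⊥E φ)) (hyp ⊥∈))
      ; prime      = limit-prime
      }

  lindenbaum : ∀ Γ φ → ¬ Γ ⊢ φ → Σ PrimeTheory λ w → Γ ⊆ (w ∋_) × ¬ w ∋ φ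
  lindenbaum Γ φ Γ⊬φ = theory , (0 ,_) , limit-⊬ ∘ hyp
    where open Lindenbaum Γ φ Γ⊬φ

  prime-counterexample : ∀ Γ α β → ¬ Γ ⊢ α ⇒ β →
                         Σ PrimeTheory λ w → Γ ⊆ (w ∋_) × w ∋ α × ¬ w ∋ β
  prime-counterexample Γ α β Γ⊬α⇒β with lindenbaum (Γ ∪ ｛ α ｝) β (Γ⊬α⇒β ∘ deduction)
  ... | w , Γα⊆w , w∌β = w , Γα⊆w ∘ inj₁ , Γα⊆w (inj₂ refl) , w∌β

  prime-valid⇒Thm : ∀ {α β} → (∀ w → w ∋ α ⇔ w ∋ β) → Thm (α ⇔' β)
  prime-valid⇒Thm {α} {β} α⇔β =
    mp (mp (ax-∧I _ _) (valid⇒Thm α β (to ∘ α⇔β))) (valid⇒Thm β α (from ∘ α⇔β))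
    where
    valid⇒Thm : ∀ α β → (∀ w → w ∋ α → w ∋ β) → Thm (α ⇒ β)
    valid⇒Thm α β valid with decide (∅ ⊢ α ⇒ β)
    ... | yes d   = ∅⊢⇒Thm d
    ... | no ∅⊬αβ with prime-counterexample ∅ α β ∅⊬αβ
    ...   | w , _ , w∋α , w∌β = ⊥-elim (w∌β (valid w w∋α))

  ⇒-counterworld : ∀ w α β → ¬ w ∋ α ⇒ β → Σ PrimeTheory λ v → w ⊑ v × v ∋ α × ¬ v ∋ β
  ⇒-counterworld w α β w∌α⇒β with decide (w ∋ α)
  ... | yes w∋α = w , inj₂ refl , w∋α , w∌α⇒β ∘ ∋-mp w (ax-K β α)
  ... | no w∌α with prime-counterexample (w ∋_) α β (w∌α⇒β ∘ closed w)
  ...   | v , w⊆v , v∋α , v∌β = v , inj₁ (w⊆v , α , v∋α , w∌α) , v∋α , v∌β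

  truth-⇒ : ∀ {α β} → TruthLemma α → TruthLemma β → TruthLemma (α ⇒ β)
  truth-⇒ {α} {β} truthα truthβ w = mk⇔ forced⇒∋ ∋⇒forced
    where
    forced⇒∋ : w ⊩ᶜ α ⇒ β → w ∋ α ⇒ β
    forced⇒∋ w⊩α⇒β with decide (w ∋ α ⇒ β)
    ... | yes w∋α⇒β = w∋α⇒β
    ... | no w∌α⇒β with ⇒-counterworld w α β w∌α⇒β
    ...   | v , w⊑v , v∋α , v∌β =
      ⊥-elim ([ (λ v⊮α → v⊮α (from (truthα v) v∋α)) , v∌β ∘ to (truthβ v) ] (w⊩α⇒β v w⊑v))

    ∋⇒forced : w ∋ α ⇒ β → w ⊩ᶜ α ⇒ β
    ∋⇒forced w∋α⇒β v w⊑v with lem {v ⊩ᶜ α}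
    ... | no v⊮α  = inj₁ v⊮α
    ... | yes v⊩α = inj₂ (from (truthβ v)
                    (closed v (mp (hyp (⊑⇒⊆ w⊑v w∋α⇒β)) (hyp (to (truthα v) v⊩α)))))

  truth-⊥ : TruthLemma ⊥'
  truth-⊥ w = mk⇔ (λ ()) (⊥-elim ∘ consistent w)

  truth : ∀ α → TruthLemma α
  truth (var q)  w = mk⇔ lower lift
  truth ⊥'         = truth-⊥
  truth (α ∧' β) w = mk⇔
    (λ { (w⊩α , w⊩β) → closed w (mp (mp (thm (ax-∧I α β)) (hyp (to (truth α w) w⊩α)))
                                          (hyp (to (truth β w) w⊩β))) })
    (λ w∋α∧β → from (truth α w) (∋-mp w (ax-∧E₁ α β) w∋α∧β)
             , from (truth β w) (∋-mp w (ax-∧E₂ α β) w∋α∧β))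
  truth (α ∨' β) w = mk⇔
    (λ { (inj₁ w⊩α) → ∋-mp w (ax-∨I₁ α β) (to (truth α w) w⊩α)
       ; (inj₂ w⊩β) → ∋-mp w (ax-∨I₂ α β) (to (truth β w) w⊩β) })
    (λ w∋α∨β → ⊎-map (from (truth α w)) (from (truth β w)) (prime w w∋α∨β))
  truth (α ⇒ β)    = truth-⇒ (truth α) (truth β)
  truth (𝖶 α)    w = mk⇔ forced⇒∋ ∋⇒forced
    where
    forced⇒∋ : w ⊩ᶜ 𝖶 α → w ∋ 𝖶 α
    forced⇒∋ (_ , β , w∋𝖶β , X⊆ , ⊆X) = ∋-mp w (mp (ax-∧E₂ _ _) (re-W α⇔β)) w∋𝖶β
      where
      α⇔β : Thm (α ⇔' β)
      α⇔β = prime-valid⇒Thm λ v →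
        mk⇔ (X⊆ ∘ from (truth α v)) (to (truth α v) ∘ ⊆X)

    ∋⇒forced : w ∋ 𝖶 α → w ⊩ᶜ 𝖶 α
    ∋⇒forced w∋𝖶α =
      from (truth-⇒ (truth α) truth-⊥ w) (∋-mp w (ax-W α) w∋𝖶α) ,
      α , w∋𝖶α , to (truth α _) , from (truth α _)

  canonical-stronglyComplete : ∀ {Class} → Class canonicalFrame → StronglyComplete Class
  canonical-stronglyComplete class Γ φ Γ⊬Wφ with lindenbaum Γ φ (Γ⊬Wφ ∘ ⊢⇒⊢W)
  ... | w , Γ⊆w , w∌φ =
    canonicalFrame , class , canonicalModel , w ,
    (λ γ → from (truth γ w) ∘ Γ⊆w) , w∌φ ∘ to (truth φ w)

mainTheorem4 : ExcludedMiddle (lsuc lzero) →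
    StronglyComplete IsWFrame × StronglyComplete IsMonotoneFrame
mainTheorem4 lem =
  canonical-stronglyComplete lem (monotone⇒WFrame canonicalFrame canonicalFrame-monotone) ,
  canonical-stronglyComplete lem canonicalFrame-monotone
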